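{- For every positive integer $n$ with $n\equiv 1$ or $2\pmod 4$, $$t(1,1,4,6;n)=2\,N(1,1,4,6;\,2n+3).$$
   Context: For positive integers $a,b,c,d$ and an integer $n\ge 0$, $N(a,b,c,d;n)$ denotes the number of $(x,y,z,w)\in\mathbb Z^4$ with $n=ax^2+by^2+cz^2+dw^2$, and $t(a,b,c,d;n)$ denotes the number of $(x,y,z,w)\in\mathbb Z^4$ with $n=a\frac{x(x-1)}2+b\frac{y(y-1)}2+c\frac{z(z-1)}2+d\frac{w(w-1)}2$. -}

module Defs where

open import Data.Nat as ℕ using (ℕ; suc; _+_; _*_; _/_)
open import Data.Integer as ℤ using (ℤ; +_; -[1+_]; ∣_∣)
open import Data.List using (List; []; _∷_; _++_; map; concatMap; filter; length; upTo; reverse)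
open import Data.Nat.Properties using (_≟_)

intRange : ℕ → List ℤ
intRange B = map (λ k → -[1+ k ]) (reverse (upTo B)) ++ map +_ (upTo (suc B))

open import Data.Product using (_×_; _,_)

box : ℕ → List (ℤ × ℤ × ℤ × ℤ)
box B = concatMap (λ x → concatMap (λ y → concatMap (λ z → map (λ w → (x , y , z , w))
          (intRange B)) (intRange B)) (intRange B)) (intRange B)

sq : ℤ → ℕ
sq x = ∣ x ℤ.* x ∣

-- x(x-1)/2 as a natural number (x(x-1) ≥ 0 is even for every integer x)
tri : ℤ → ℕ
tri x = ∣ x ℤ.* (x ℤ.- ℤ.1ℤ) ∣ / 2

qform : ℕ → ℕ → ℕ → ℕ → (ℤ × ℤ × ℤ × ℤ) → ℕ
qform a b c d (x , y , z , w) = a * sq x + b * sq y + c * sq z + d * sq w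

tform : ℕ → ℕ → ℕ → ℕ → (ℤ × ℤ × ℤ × ℤ) → ℕ
tform a b c d (x , y , z , w) = a * tri x + b * tri y + c * tri z + d * tri w

-- N(a,b,c,d;n): number of (x,y,z,w) ∈ ℤ^4 with n = ax²+by²+cz²+dw².
-- For a,b,c,d ≥ 1 every solution satisfies |x|,|y|,|z|,|w| ≤ n, so counting in
-- the box [-n,n]^4 counts all solutions.
N : ℕ → ℕ → ℕ → ℕ → ℕ → ℕ
N a b c d n = length (filter (λ v → qform a b c d v ≟ n) (box n))

-- For a,b,c,d ≥ 1 every solution has x(x-1)/2 ≤ n, hence |x| ≤ 2n+1;
-- so counting in the box [-(2n+1),2n+1]^4 counts all solutions.
t : ℕ → ℕ → ℕ → ℕ → ℕ → ℕ
t a b c d n = length (filter (λ v → tform a b c d v ≟ n) (box (2 * n + 1)))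

-- With X = 2x − 1 one has 8 · x(x − 1)/2 + 1 = X², so t(1,1,4,6;n) counts the representations
-- 4m = X² + Y² + 4Z² + 6W², m = 2n + 3, with X, Y, Z, W odd.  Both this count and N(1,1,4,6;m)
-- are expressed through the representations m = 2a² + 2c² + y² + 6w²:
--   * m is odd, so in m = x² + y² + 4z² + 6w² exactly one of x, y is even; putting the even one
--     first, x = 2p, the substitution (a, c) = (z − p, p + z) gives N = 2 · #{2a² + 2c² + y² + 6w² = m};
--   * (X, Y, Z, W) = (2c + d, ±(2c − d), y, ±(d + 4w)) with d = a − 3w satisfies
--     X² + Y² + 4Z² + 6W² = 4(2a² + 2c² + y² + 6w²), and every odd solution arises in this way for
--     exactly one choice of the two signs, because of two odd numbers ±v exactly one is ≡ u (mod 4).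
-- Hence t = 4 · #{2a² + 2c² + y² + 6w² = m} = 2N.  The condition m ≡ 5, 7 (mod 8), i.e.
-- n ≡ 1, 2 (mod 4), is what makes both substitutions surjective: modulo 8 it forces a ≡ c (mod 2),
-- so that p and z are integers, and a + w odd, so that X, Y and W are odd.

module Submission where

open import Data.Bool using (Bool; true; false)
open import Data.Empty using (⊥; ⊥-elim)
open import Data.Integer using (ℤ; +_; -[1+_]; ∣_∣)
open import Data.Product using (Σ; ∃; ∃₂; _×_; _,_; proj₁; proj₂)
open import Data.Sum using (_⊎_; inj₁; inj₂)
open import Function.Base using (_∘_)
open import Function.Bundles using (_↔_; mk↔ₛ′)
open import Relation.Binary.PropositionalEquality
open import Relation.Nullary.Irrelevant using (Irrelevant)
open import Defs

ℤ⁴ : Set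
ℤ⁴ = ℤ × ℤ × ℤ × ℤ

componentwise : ∀ {A : Set} {x y z w x′ y′ z′ w′ : A} →
                x ≡ x′ → y ≡ y′ → z ≡ z′ → w ≡ w′ → (x , y , z , w) ≡ (x′ , y′ , z′ , w′)
componentwise refl refl refl refl = refl

module _ {A B : Set} {P : A → Set} {R : B → Set} where

  Σ-map-↔ : (f : A → B) → (∀ {x} → Irrelevant (P x)) → (∀ {y} → Irrelevant (R y)) →
            (∀ {x} → P x → R (f x)) →
            (∀ {x x′} → P x → P x′ → f x ≡ f x′ → x ≡ x′) →
            (∀ {y} → R y → ∃ λ x → P x × f x ≡ y) →
            Σ A P ↔ Σ B R
  Σ-map-↔ f P-irrelevant R-irrelevant f-sound f-injective f-onto =
    mk↔ₛ′ to from (λ (_ , r) → to-pick r (f-onto r)) (λ (_ , p) → pick-unique p (f-onto (f-sound p)))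
    where
    to : Σ A P → Σ B R
    to (x , p) = f x , f-sound p

    pick : ∀ {y} → (∃ λ x → P x × f x ≡ y) → Σ A P
    pick (x , p , _) = x , p

    from : Σ B R → Σ A P
    from (_ , r) = pick (f-onto r)

    to-pick : ∀ {y} (r : R y) (o : ∃ λ x → P x × f x ≡ y) → to (pick o) ≡ (y , r)
    to-pick r (x , p , refl) = cong (f x ,_) (R-irrelevant _ _)

    pick-unique : ∀ {x} (p : P x) (o : ∃ λ x′ → P x′ × f x′ ≡ f x) → pick o ≡ (x , p)
    pick-unique p (x′ , p′ , fx′≡fx) with f-injective p′ p fx′≡fx
    ... | refl = cong (x′ ,_) (P-irrelevant p′ p)

module _ where
  open import Data.Fin using (Fin; zero; suc)
  open import Data.List using (List; []; _∷_; concatMap; filter; length)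
  open import Data.List.Properties using (reverse-upTo)
  open import Data.List.Membership.Propositional using (_∈_)
  open import Data.List.Membership.Propositional.Properties
    using (∈-filter⁺; ∈-filter⁻; ∈-map⁺; ∈-map⁻; ∈-++⁺ˡ; ∈-++⁺ʳ; ∈-concatMap⁺; ∈-upTo⁺; ∈-downFrom⁺)
  open import Data.List.Membership.Propositional.Properties.WithK using (unique⇒irrelevant)
  open import Data.List.Relation.Unary.Any as Any using (here; there; index)
  import Data.List.Relation.Unary.All as All
  import Data.List.Relation.Unary.All.Properties as All
  open import Data.List.Relation.Unary.All using (All)
  import Data.List.Relation.Unary.AllPairs as AllPairs
  import Data.List.Relation.Unary.AllPairs.Properties as AllPairs
  open import Data.List.Relation.Binary.Disjoint.Propositional using (Disjoint)
  open import Data.List.Relation.Unary.Unique.Propositional using (Unique)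
  import Data.List.Relation.Unary.Unique.Propositional.Properties as Unique
  open import Data.Nat using (ℕ; zero; suc; _+_; _*_; _≤_; z≤n; s≤s)
  import Data.Nat.Properties as ℕ
  open import Data.Product using (map₂)
  open import Relation.Unary using (Decidable)
  import Data.Integer.Properties as ℤ
  open import Data.Nat.Tactic.RingSolver using (solve)
  open import Function.Properties.Inverse using (↔-trans)
  open ≡-Reasoning

  -- Counting the solutions that lie in a box

  Fin-length : ∀ {A : Set} (xs : List A) → Fin (length xs) ↔ ∃ (_∈ xs)
  Fin-length xs = mk↔ₛ′ (member xs) (index ∘ proj₂) member-index (index-member xs)
    where
    member : ∀ {A : Set} (xs : List A) → Fin (length xs) → ∃ (_∈ xs)
    member (x ∷ xs) zero    = x , here refl
    member (x ∷ xs) (suc i) = map₂ there (member xs i)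

    member-index : ∀ {A : Set} {xs : List A} (x∈ : ∃ (_∈ xs)) → member xs (index (proj₂ x∈)) ≡ x∈
    member-index (x , here refl)  = refl
    member-index (x , there x∈xs) = cong (map₂ there) (member-index (x , x∈xs))

    index-member : ∀ {A : Set} (xs : List A) i → index (proj₂ (member xs i)) ≡ i
    index-member (x ∷ xs) zero    = refl
    index-member (x ∷ xs) (suc i) = cong suc (index-member xs i)

  Fin-length-filter : ∀ {A : Set} {P : A → Set} (P? : Decidable P) {xs : List A} →
                      (∀ {x} → Irrelevant (P x)) → Unique xs → (∀ {x} → P x → x ∈ xs) →
                      Fin (length (filter P? xs)) ↔ Σ A P
  Fin-length-filter {A} {P} P? {xs} P-irrelevant xs-unique xs-complete =
    ↔-trans (Fin-length _) (mk↔ₛ′ to from (λ (x , p) → cong (x ,_) (P-irrelevant _ _))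
      (λ (x , x∈) → cong (x ,_) (unique⇒irrelevant (Unique.filter⁺ P? xs-unique) _ _)))
    where
    to : ∃ (_∈ filter P? xs) → Σ A P
    to (x , x∈) = x , proj₂ (∈-filter⁻ P? {xs = xs} x∈)
    from : Σ A P → ∃ (_∈ filter P? xs)
    from (x , p) = x , ∈-filter⁺ P? (xs-complete p) p

  All-concatMap : ∀ {A B : Set} {P : B → Set} (f : A → List B) xs →
                  (∀ x → All P (f x)) → All P (concatMap f xs)
  All-concatMap f xs all-f = All.concat⁺ (All.map⁺ (All.universal all-f xs))

  concatMap-unique : ∀ {A B : Set} {f : A → List B} {xs} (key : B → A) →
                     (∀ x → Unique (f x)) → (∀ x → All (λ b → key b ≡ x) (f x)) →
                     Unique xs → Unique (concatMap f xs)
  concatMap-unique {f = f} key f-unique f-keyed xs-unique =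
    Unique.concat⁺ (All.map⁺ (All.universal f-unique _)) (AllPairs.map⁺ (AllPairs.map disjoint xs-unique))
    where
    disjoint : ∀ {x y} → x ≢ y → Disjoint (f x) (f y)
    disjoint x≢y (b∈fx , b∈fy) = x≢y (trans (sym (All.lookup (f-keyed _) b∈fx)) (All.lookup (f-keyed _) b∈fy))

  ∈-concatMap : ∀ {A B : Set} {f : A → List B} {x xs b} → x ∈ xs → b ∈ f x → b ∈ concatMap f xs
  ∈-concatMap x∈xs b∈fx = ∈-concatMap⁺ _ (Any.map (λ { refl → b∈fx }) x∈xs)

  intRange-unique : ∀ B → Unique (intRange B)
  intRange-unique B = Unique.++⁺
    (Unique.map⁺ (λ { refl → refl }) (subst Unique (sym (reverse-upTo B)) (Unique.downFrom⁺ B)))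
    (Unique.map⁺ ℤ.+-injective (Unique.upTo⁺ (suc B)))
    λ (neg∈ , nonneg∈) → case-neg (∈-map⁻ -[1+_] neg∈) (∈-map⁻ +_ nonneg∈)
    where
    case-neg : ∀ {v} → (∃ λ i → _ × v ≡ -[1+ i ]) → (∃ λ j → _ × v ≡ + j) → ⊥
    case-neg (_ , _ , refl) (_ , _ , ())

  intRange-complete : ∀ {B x} → ∣ x ∣ ≤ B → x ∈ intRange B
  intRange-complete {B} {+ j}     j≤B   = ∈-++⁺ʳ _ (∈-map⁺ +_ (∈-upTo⁺ (s≤s j≤B)))
  intRange-complete {B} { -[1+ j ]} 1+j≤B =
    ∈-++⁺ˡ (∈-map⁺ -[1+_] (subst (j ∈_) (sym (reverse-upTo B)) (∈-downFrom⁺ 1+j≤B)))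

  box-unique : ∀ B → Unique (box B)
  box-unique B =
    concatMap-unique proj₁
      (λ x → concatMap-unique (proj₁ ∘ proj₂)
        (λ y → concatMap-unique (proj₁ ∘ proj₂ ∘ proj₂)
          (λ z → Unique.map⁺ (cong (proj₂ ∘ proj₂ ∘ proj₂)) R-unique)
          (λ z → All.map⁺ (All.universal (λ _ → refl) _)) R-unique)
        (λ y → All-concatMap _ R λ z → All.map⁺ (All.universal (λ _ → refl) R)) R-unique)
      (λ x → All-concatMap _ R λ y → All-concatMap _ R λ z → All.map⁺ (All.universal (λ _ → refl) R)) R-unique
    where
    R : List ℤ
    R = intRange B
    R-unique : Unique R
    R-unique = intRange-unique B

  box-complete : ∀ {B x y z w} → ∣ x ∣ ≤ B → ∣ y ∣ ≤ B → ∣ z ∣ ≤ B → ∣ w ∣ ≤ B →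
                 (x , y , z , w) ∈ box B
  box-complete x≤B y≤B z≤B w≤B =
    ∈-concatMap (intRange-complete x≤B) (∈-concatMap (intRange-complete y≤B)
      (∈-concatMap (intRange-complete z≤B) (∈-map⁺ _ (intRange-complete w≤B))))

  weighted-sum-bounds : ∀ p q r s → let S = 1 * p + 1 * q + 4 * r + 6 * s in
                        p ≤ S × q ≤ S × r ≤ S × s ≤ S
  weighted-sum-bounds p q r s =
    ℕ.≤-trans (ℕ.m≤m+n p 0) (ℕ.≤-trans (ℕ.m≤m+n (1 * p) (1 * q)) S₂≤S) ,
    ℕ.≤-trans (ℕ.m≤m+n q 0) (ℕ.≤-trans (ℕ.m≤n+m (1 * q) (1 * p)) S₂≤S) ,
    ℕ.≤-trans (ℕ.m≤n*m r 4) (ℕ.≤-trans (ℕ.m≤n+m (4 * r) (1 * p + 1 * q)) S₃≤S) ,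
    ℕ.≤-trans (ℕ.m≤n*m s 6) (ℕ.m≤n+m (6 * s) (1 * p + 1 * q + 4 * r))
    where
    S₃≤S : 1 * p + 1 * q + 4 * r ≤ 1 * p + 1 * q + 4 * r + 6 * s
    S₃≤S = ℕ.m≤m+n _ (6 * s)
    S₂≤S : 1 * p + 1 * q ≤ 1 * p + 1 * q + 4 * r + 6 * s
    S₂≤S = ℕ.≤-trans (ℕ.m≤m+n _ (4 * r)) S₃≤S

  ∈-box-if-weighted-sum : ∀ (g : ℤ → ℕ) {B C} → (∀ {x} → g x ≤ B → ∣ x ∣ ≤ C) →
                          ∀ {x y z w} → 1 * g x + 1 * g y + 4 * g z + 6 * g w ≡ B →
                          (x , y , z , w) ∈ box C
  ∈-box-if-weighted-sum g bound {x} {y} {z} {w} refl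
    with gx≤ , gy≤ , gz≤ , gw≤ ← weighted-sum-bounds (g x) (g y) (g z) (g w)
    = box-complete (bound gx≤) (bound gy≤) (bound gz≤) (bound gw≤)

  ∣x∣≤sq : ∀ x → ∣ x ∣ ≤ sq x
  ∣x∣≤sq x rewrite ℤ.abs-* x x with ∣ x ∣
  ... | zero  = z≤n
  ... | suc k = ℕ.m≤m*n (suc k) (suc k)

  -- Triangular numbers

  triangle : ℕ → ℕ
  triangle zero    = zero
  triangle (suc k) = suc k + triangle k

  n≤triangle : ∀ n → n ≤ triangle n
  n≤triangle zero    = z≤n
  n≤triangle (suc n) = ℕ.m≤m+n (suc n) (triangle n)

  triangle*2 : ∀ k → triangle k * 2 ≡ k * suc k
  triangle*2 zero    = refl
  triangle*2 (suc k) = begin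
    (suc k + triangle k) * 2         ≡⟨ ℕ.*-distribʳ-+ 2 (suc k) (triangle k) ⟩
    suc k * 2 + triangle k * 2       ≡⟨ cong (λ t → suc k * 2 + t) (triangle*2 k) ⟩
    suc k * 2 + k * suc k            ≡⟨ solve (k ∷ []) ⟩
    suc k * suc (suc k)              ∎

module _ where
  open import Algebra.Bundles using (AbelianGroup)
  open import Axiom.UniquenessOfIdentityProofs.WithK using (uip)
  open import Data.Integer using (-_; _+_; _-_; _*_)
  import Data.Integer.Properties as ℤ
  open import Algebra.Properties.Group (AbelianGroup.group ℤ.+-0-abelianGroup) using (∙-cancelˡ; ∙-cancelʳ)
  open import Data.Integer.DivMod using (_%ℕ_; _/ℕ_; a≡a%ℕn+[a/ℕn]*n; n%ℕd<d)
  open import Data.Integer.Divisibility.Signed using (_∣_; divides; _∣?_; ∣-trans)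
  open import Data.Integer.Tactic.RingSolver using (solve; solve-∀)
  open import Data.List using ([]; _∷_)
  open import Data.List.Membership.Propositional using (_∈_)
  open import Data.Nat as ℕ using (ℕ)
  open import Data.Fin using (Fin)
  open import Data.Product.Algebra using (Σ-assoc-alt)
  open import Data.Product.Function.NonDependent.Propositional using (_×-↔_)
  import Data.Sum as Sum
  open import Function.Properties.Inverse using (↔-refl; ↔-sym; ↔-trans)
  import Data.Nat.Properties as ℕ
  open import Data.Nat.DivMod using (m≡m%n+[m/n]*n; m*n/n≡m)
  open import Data.Product.Properties using (,-injectiveˡ; ,-injectiveʳ)
  open import Relation.Nullary.Decidable using (False; toWitnessFalse; from-no)
  open ≡-Reasoning

  -- Congruences and parity

  infix 4 _≡_mod_
  record _≡_mod_ (x y k : ℤ) : Set where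
    constructor congruent
    field divides-difference : k ∣ x - y

  open _≡_mod_ using (divides-difference)

  ≡mod-sym : ∀ {x y k} → x ≡ y mod k → y ≡ x mod k
  ≡mod-sym {x} {y} {k} (congruent (divides q x-y≡qk)) = congruent (divides (- q) (begin
    y - x     ≡⟨ solve (x ∷ y ∷ []) ⟩
    - (x - y) ≡⟨ cong -_ x-y≡qk ⟩
    - (q * k) ≡⟨ solve (q ∷ k ∷ []) ⟩
    - q * k   ∎))

  ≡mod-trans : ∀ {x y z k} → x ≡ y mod k → y ≡ z mod k → x ≡ z mod k
  ≡mod-trans {x} {y} {z} {k} (congruent (divides q x-y≡qk)) (congruent (divides q′ y-z≡q′k)) =
    congruent (divides (q + q′) (begin
      x - z             ≡⟨ solve (x ∷ y ∷ z ∷ []) ⟩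
      (x - y) + (y - z) ≡⟨ cong₂ _+_ x-y≡qk y-z≡q′k ⟩
      q * k + q′ * k    ≡⟨ solve (q ∷ q′ ∷ k ∷ []) ⟩
      (q + q′) * k      ∎))

  +-cong-mod : ∀ {x x′ y y′ k} → x ≡ x′ mod k → y ≡ y′ mod k → x + y ≡ x′ + y′ mod k
  +-cong-mod {x} {x′} {y} {y′} {k} (congruent (divides q x-x′≡qk)) (congruent (divides q′ y-y′≡q′k)) =
    congruent (divides (q + q′) (begin
      (x + y) - (x′ + y′) ≡⟨ solve (x ∷ x′ ∷ y ∷ y′ ∷ []) ⟩
      (x - x′) + (y - y′) ≡⟨ cong₂ _+_ x-x′≡qk y-y′≡q′k ⟩
      q * k + q′ * k      ≡⟨ solve (q ∷ q′ ∷ k ∷ []) ⟩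
      (q + q′) * k        ∎))

  *-cong-mod : ∀ c {x y k} → x ≡ y mod k → c * x ≡ c * y mod c * k
  *-cong-mod c {x} {y} {k} (congruent (divides q x-y≡qk)) = congruent (divides q (begin
    c * x - c * y ≡⟨ solve (c ∷ x ∷ y ∷ []) ⟩
    c * (x - y)   ≡⟨ cong (c *_) x-y≡qk ⟩
    c * (q * k)   ≡⟨ solve (c ∷ q ∷ k ∷ []) ⟩
    q * (c * k)   ∎))

  ≡mod-weaken : ∀ {x y k d} → d ∣ k → x ≡ y mod k → x ≡ y mod d
  ≡mod-weaken d∣k (congruent k∣x-y) = congruent (∣-trans d∣k k∣x-y)

  Even Odd : ℤ → Set
  Even x = ∃ λ k → x ≡ + 2 * k
  Odd  x = ∃ λ k → x ≡ + 2 * k - + 1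

  parity : ∀ x → Even x ⊎ Odd x
  parity x with x /ℕ 2 | x %ℕ 2 | a≡a%ℕn+[a/ℕn]*n x 2 | n%ℕd<d x 2
  ... | q | 0 | x≡ | _ = inj₁ (q , trans x≡ (begin + 0 + q * + 2 ≡⟨ solve (q ∷ []) ⟩ + 2 * q ∎))
  ... | q | 1 | x≡ | _ = inj₂ (q + + 1 , trans x≡ (begin
    + 1 + q * + 2 ≡⟨ solve (q ∷ []) ⟩ + 2 * (q + + 1) - + 1 ∎))
  ... | _ | ℕ.suc (ℕ.suc _) | _ | ℕ.s≤s (ℕ.s≤s ())

  Even-Odd-disjoint : ∀ {x} → Even x → Odd x → ⊥
  Even-Odd-disjoint (k , refl) (j , 2k≡2j-1) = from-no (+ 2 ∣? + 1) (divides (j - k) (begin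
    + 1                       ≡⟨ solve (j ∷ []) ⟩
    + 2 * j - (+ 2 * j - + 1) ≡⟨ cong (λ t → + 2 * j - t) (sym 2k≡2j-1) ⟩
    + 2 * j - + 2 * k         ≡⟨ solve (j ∷ k ∷ []) ⟩
    (j - k) * + 2             ∎))

  odd-injective : ∀ {k k′} → + 2 * k - + 1 ≡ + 2 * k′ - + 1 → k ≡ k′
  odd-injective {k} {k′} e = ℤ.*-cancelˡ-≡ (+ 2) k k′ (∙-cancelʳ (- + 1) _ _ e)

  Odd-irrelevant : ∀ {x} → Irrelevant (Odd x)
  Odd-irrelevant (k , refl) (k′ , e) with odd-injective {k} {k′} e
  ... | refl = cong (k ,_) (uip refl e)

  Odd-neg : ∀ {x} → Odd x → Odd (- x)
  Odd-neg (k , refl) = + 1 - k , solve (k ∷ [])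

  Odd-shift : ∀ {x} c → Odd x → Odd (x - + 2 * c)
  Odd-shift c (k , refl) = k - c , solve (k ∷ c ∷ [])

  m+n≡o⇒m≡o-n : ∀ {x y z} → x + y ≡ z → x ≡ z - y
  m+n≡o⇒m≡o-n {x} {y} refl = begin x ≡⟨ solve (x ∷ y ∷ []) ⟩ x + y - y ∎

  m+n≡o⇒n≡o-m : ∀ {x y z} → x + y ≡ z → y ≡ z - x
  m+n≡o⇒n≡o-m {x} {y} refl = begin y ≡⟨ solve (x ∷ y ∷ []) ⟩ x + y - x ∎

  -- Signs modulo 4

  negateIf : Bool → ℤ → ℤ
  negateIf false x = x
  negateIf true  x = - x

  negateIf-involutive : ∀ b x → negateIf b (negateIf b x) ≡ x
  negateIf-involutive false x = refl
  negateIf-involutive true  x = ℤ.neg-involutive x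

  negateIf-square : ∀ b x → negateIf b x * negateIf b x ≡ x * x
  negateIf-square false x = refl
  negateIf-square true  x = begin - x * - x ≡⟨ solve (x ∷ []) ⟩ x * x ∎

  Odd-negateIf : ∀ b {x} → Odd x → Odd (negateIf b x)
  Odd-negateIf false = λ x-odd → x-odd
  Odd-negateIf true  = Odd-neg

  ±-normalisation : ∀ {u v} → Odd u → Odd v → (∃ λ k → v ≡ u + + 4 * k) ⊎ (∃ λ k → - v ≡ u + + 4 * k)
  ±-normalisation (i , refl) (j , refl) with parity i | parity j
  ... | inj₁ (i′ , refl) | inj₁ (j′ , refl) = inj₁ (j′ - i′ , (begin
    + 2 * (+ 2 * j′) - + 1                          ≡⟨ solve (i′ ∷ j′ ∷ []) ⟩
    (+ 2 * (+ 2 * i′) - + 1) + + 4 * (j′ - i′)      ∎))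
  ... | inj₂ (i′ , refl) | inj₂ (j′ , refl) = inj₁ (j′ - i′ , (begin
    + 2 * (+ 2 * j′ - + 1) - + 1                    ≡⟨ solve (i′ ∷ j′ ∷ []) ⟩
    (+ 2 * (+ 2 * i′ - + 1) - + 1) + + 4 * (j′ - i′) ∎))
  ... | inj₁ (i′ , refl) | inj₂ (j′ , refl) = inj₂ (+ 1 - i′ - j′ , (begin
    - (+ 2 * (+ 2 * j′ - + 1) - + 1)                ≡⟨ solve (i′ ∷ j′ ∷ []) ⟩
    (+ 2 * (+ 2 * i′) - + 1) + + 4 * (+ 1 - i′ - j′) ∎))
  ... | inj₂ (i′ , refl) | inj₁ (j′ , refl) = inj₂ (+ 1 - i′ - j′ , (begin
    - (+ 2 * (+ 2 * j′) - + 1)                      ≡⟨ solve (i′ ∷ j′ ∷ []) ⟩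
    (+ 2 * (+ 2 * i′ - + 1) - + 1) + + 4 * (+ 1 - i′ - j′) ∎))

  sign-normalisation : ∀ {u v} → Odd u → Odd v → ∃₂ λ b k → negateIf b v ≡ u + + 4 * k
  sign-normalisation u-odd v-odd with ±-normalisation u-odd v-odd
  ... | inj₁ (k , v≡u+4k)  = false , k , v≡u+4k
  ... | inj₂ (k , -v≡u+4k) = true  , k , -v≡u+4k

  opposite-residues : ∀ {u k k′} → - (u + + 4 * k) ≡ u + + 4 * k′ → Even u
  opposite-residues {u} {k} {k′} e = - (k + k′) , ℤ.*-cancelˡ-≡ (+ 2) u (+ 2 * - (k + k′)) (begin
    + 2 * u                                              ≡⟨ solve (u ∷ k ∷ k′ ∷ []) ⟩
    (u + + 4 * k′) - (- (u + + 4 * k)) - + 4 * (k + k′) ≡⟨ cong (λ t → (u + + 4 * k′) - t - + 4 * (k + k′)) e ⟩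
    (u + + 4 * k′) - (u + + 4 * k′) - + 4 * (k + k′)    ≡⟨ solve (u ∷ k ∷ k′ ∷ []) ⟩
    + 2 * (+ 2 * - (k + k′))                             ∎)

  sign-normalisation-unique : ∀ b b′ {u v k k′} → Odd u →
                              negateIf b v ≡ u + + 4 * k → negateIf b′ v ≡ u + + 4 * k′ → b ≡ b′ × k ≡ k′
  sign-normalisation-unique false false {u} _ refl e′ =
    refl , ℤ.*-cancelˡ-≡ (+ 4) _ _ (∙-cancelˡ u _ _ e′)
  sign-normalisation-unique true  true  {u} _ e    e′ =
    refl , ℤ.*-cancelˡ-≡ (+ 4) _ _ (∙-cancelˡ u _ _ (trans (sym e) e′))
  sign-normalisation-unique false true  u-odd refl e′ = ⊥-elim (Even-Odd-disjoint (opposite-residues e′) u-odd)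
  sign-normalisation-unique true  false u-odd e refl = ⊥-elim (Even-Odd-disjoint (opposite-residues e) u-odd)

  -- The quadratic forms

  Q₁₁₄₆ Q₄₁₄₆ Q₂₂₁₆ : ℤ⁴ → ℤ
  Q₁₁₄₆ (x , y , z , w) = x * x + y * y + + 4 * (z * z) + + 6 * (w * w)
  Q₄₁₄₆ (p , y , z , w) = Q₁₁₄₆ (+ 2 * p , y , z , w)
  Q₂₂₁₆ (a , c , y , w) = + 2 * (a * a) + + 2 * (c * c) + y * y + + 6 * (w * w)

  Solutions : (ℤ⁴ → ℤ) → ℤ → Set
  Solutions Φ m = Σ ℤ⁴ λ v → Φ v ≡ m

  Q₁₁₄₆-parity : ∀ x y z w → Odd (Q₁₁₄₆ (x , y , z , w)) → Even x × Odd y ⊎ Odd x × Even y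
  Q₁₁₄₆-parity x y z w Q-odd with parity x | parity y
  ... | inj₁ x-even | inj₂ y-odd = inj₁ (x-even , y-odd)
  ... | inj₂ x-odd | inj₁ y-even = inj₂ (x-odd , y-even)
  ... | inj₁ (i , refl) | inj₁ (j , refl) = ⊥-elim (Even-Odd-disjoint (_ , (begin
    (+ 2 * i) * (+ 2 * i) + (+ 2 * j) * (+ 2 * j) + + 4 * (z * z) + + 6 * (w * w) ≡⟨ solve (i ∷ j ∷ z ∷ w ∷ []) ⟩
    + 2 * (+ 2 * (i * i + j * j + z * z) + + 3 * (w * w))                           ∎)) Q-odd)
  ... | inj₂ (i , refl) | inj₂ (j , refl) = ⊥-elim (Even-Odd-disjoint (_ , (begin
    (+ 2 * i - + 1) * (+ 2 * i - + 1) + (+ 2 * j - + 1) * (+ 2 * j - + 1) + + 4 * (z * z) + + 6 * (w * w)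
      ≡⟨ solve (i ∷ j ∷ z ∷ w ∷ []) ⟩
    + 2 * (+ 2 * (i * i - i + j * j - j + z * z) + + 3 * (w * w) + + 1)               ∎)) Q-odd)

  infix 4 _≡5∨7mod8
  _≡5∨7mod8 : ℤ → Set
  m ≡5∨7mod8 = m ≡ + 5 mod + 8 ⊎ m ≡ + 7 mod + 8

  ≡5∨7mod8⇒Odd : ∀ {m} → m ≡5∨7mod8 → Odd m
  ≡5∨7mod8⇒Odd {m} (inj₁ (congruent (divides q m-5≡8q))) = + 4 * q + + 3 , (begin
    m                      ≡⟨ solve (m ∷ []) ⟩
    (m - + 5) + + 5        ≡⟨ cong (_+ + 5) m-5≡8q ⟩
    q * + 8 + + 5          ≡⟨ solve (q ∷ []) ⟩
    + 2 * (+ 4 * q + + 3) - + 1 ∎)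
  ≡5∨7mod8⇒Odd {m} (inj₂ (congruent (divides q m-7≡8q))) = + 4 * q + + 4 , (begin
    m                      ≡⟨ solve (m ∷ []) ⟩
    (m - + 7) + + 7        ≡⟨ cong (_+ + 7) m-7≡8q ⟩
    q * + 8 + + 7          ≡⟨ solve (q ∷ []) ⟩
    + 2 * (+ 4 * q + + 4) - + 1 ∎)

  -- For a concrete residue r both side conditions evaluate to ⊤ and are filled in automatically.
  ≢5∨7mod8 : ∀ {x r} → x ≡ r mod + 8 → x ≡5∨7mod8 →
             {False (+ 8 ∣? r - + 5)} → {False (+ 8 ∣? r - + 7)} → ⊥
  ≢5∨7mod8 x≡r (inj₁ x≡5) {r≢5} = toWitnessFalse r≢5 (divides-difference (≡mod-trans (≡mod-sym x≡r) x≡5))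
  ≢5∨7mod8 x≡r (inj₂ x≡7) {_} {r≢7} = toWitnessFalse r≢7 (divides-difference (≡mod-trans (≡mod-sym x≡r) x≡7))

  bit : ∀ {x} → Even x ⊎ Odd x → ℤ
  bit (inj₁ _) = + 0
  bit (inj₂ _) = + 1

  square-mod4 : ∀ {x} (p : Even x ⊎ Odd x) → x * x ≡ bit p mod + 4
  square-mod4 (inj₁ (k , refl)) = congruent (divides (k * k) (begin
    (+ 2 * k) * (+ 2 * k) - + 0 ≡⟨ solve (k ∷ []) ⟩ k * k * + 4 ∎))
  square-mod4 (inj₂ (k , refl)) = congruent (divides (k * k - k) (begin
    (+ 2 * k - + 1) * (+ 2 * k - + 1) - + 1 ≡⟨ solve (k ∷ []) ⟩ (k * k - k) * + 4 ∎))

  odd-square-mod8 : ∀ {x} → Odd x → x * x ≡ + 1 mod + 8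
  odd-square-mod8 (k , refl) with parity k
  ... | inj₁ (j , refl) = congruent (divides (+ 2 * (j * j) - j) (begin
    (+ 2 * (+ 2 * j) - + 1) * (+ 2 * (+ 2 * j) - + 1) - + 1 ≡⟨ solve (j ∷ []) ⟩
    (+ 2 * (j * j) - j) * + 8                                ∎))
  ... | inj₂ (j , refl) = congruent (divides (+ 2 * (j * j) - + 3 * j + + 1) (begin
    (+ 2 * (+ 2 * j - + 1) - + 1) * (+ 2 * (+ 2 * j - + 1) - + 1) - + 1 ≡⟨ solve (j ∷ []) ⟩
    (+ 2 * (j * j) - + 3 * j + + 1) * + 8                                ∎))

  Q₂₂₁₆-mod8 : ∀ {a c y w} (pa : Even a ⊎ Odd a) (pc : Even c ⊎ Odd c) (pw : Even w ⊎ Odd w) → Odd y →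
               Q₂₂₁₆ (a , c , y , w) ≡ + 2 * bit pa + + 2 * bit pc + + 1 + + 6 * bit pw mod + 8
  Q₂₂₁₆-mod8 {a} {c} {y} {w} pa pc pw y-odd = +-cong-mod (+-cong-mod (+-cong-mod 2a² 2c²) y²) 6w²
    where
    2a² : + 2 * (a * a) ≡ + 2 * bit pa mod + 8
    2a² = *-cong-mod (+ 2) (square-mod4 pa)
    2c² : + 2 * (c * c) ≡ + 2 * bit pc mod + 8
    2c² = *-cong-mod (+ 2) (square-mod4 pc)
    y² : y * y ≡ + 1 mod + 8
    y² = odd-square-mod8 y-odd
    6w² : + 6 * (w * w) ≡ + 6 * bit pw mod + 8
    6w² = ≡mod-weaken (divides (+ 3) refl) (*-cong-mod (+ 6) (square-mod4 pw))

  -- Modulo 8, Q₂₂₁₆ (a , c , y , w) ≡ 2 bit(a) + 2 bit(c) + 1 + 6 bit(w), which is 5 or 7 only in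
  -- the two positive cases below.
  Q₂₂₁₆-parities : ∀ {a c y w m} → m ≡5∨7mod8 → Q₂₂₁₆ (a , c , y , w) ≡ m →
                   Odd y × Even (a + c) × Odd (a + w)
  Q₂₂₁₆-parities {a} {c} {y} {w} m≡5∨7 refl with parity y
  ... | inj₁ (j , refl) = ⊥-elim (Even-Odd-disjoint (_ , (begin
    + 2 * (a * a) + + 2 * (c * c) + (+ 2 * j) * (+ 2 * j) + + 6 * (w * w) ≡⟨ solve (a ∷ c ∷ j ∷ w ∷ []) ⟩
    + 2 * (a * a + c * c + + 2 * (j * j) + + 3 * (w * w))                 ∎)) (≡5∨7mod8⇒Odd m≡5∨7))
  ... | inj₂ y-odd with parity a | parity c | parity w
  ...   | inj₁ (a′ , refl) | inj₁ (c′ , refl) | inj₂ (w′ , refl) =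
    y-odd ,
    (a′ + c′ , (begin
      + 2 * a′ + + 2 * c′ ≡⟨ solve (a′ ∷ c′ ∷ []) ⟩ + 2 * (a′ + c′) ∎)) ,
    (a′ + w′ , (begin
      + 2 * a′ + (+ 2 * w′ - + 1) ≡⟨ solve (a′ ∷ w′ ∷ []) ⟩ + 2 * (a′ + w′) - + 1 ∎))
  ...   | inj₂ (a′ , refl) | inj₂ (c′ , refl) | inj₁ (w′ , refl) =
    y-odd ,
    (a′ + c′ - + 1 , (begin
      (+ 2 * a′ - + 1) + (+ 2 * c′ - + 1) ≡⟨ solve (a′ ∷ c′ ∷ []) ⟩ + 2 * (a′ + c′ - + 1) ∎)) ,
    (a′ + w′ , (begin
      (+ 2 * a′ - + 1) + + 2 * w′ ≡⟨ solve (a′ ∷ w′ ∷ []) ⟩ + 2 * (a′ + w′) - + 1 ∎))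
  ...   | pa@(inj₁ _) | pc@(inj₁ _) | pw@(inj₁ _) = ⊥-elim (≢5∨7mod8 (Q₂₂₁₆-mod8 pa pc pw y-odd) m≡5∨7)
  ...   | pa@(inj₁ _) | pc@(inj₂ _) | pw@(inj₁ _) = ⊥-elim (≢5∨7mod8 (Q₂₂₁₆-mod8 pa pc pw y-odd) m≡5∨7)
  ...   | pa@(inj₁ _) | pc@(inj₂ _) | pw@(inj₂ _) = ⊥-elim (≢5∨7mod8 (Q₂₂₁₆-mod8 pa pc pw y-odd) m≡5∨7)
  ...   | pa@(inj₂ _) | pc@(inj₁ _) | pw@(inj₁ _) = ⊥-elim (≢5∨7mod8 (Q₂₂₁₆-mod8 pa pc pw y-odd) m≡5∨7)
  ...   | pa@(inj₂ _) | pc@(inj₁ _) | pw@(inj₂ _) = ⊥-elim (≢5∨7mod8 (Q₂₂₁₆-mod8 pa pc pw y-odd) m≡5∨7)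
  ...   | pa@(inj₂ _) | pc@(inj₂ _) | pw@(inj₂ _) = ⊥-elim (≢5∨7mod8 (Q₂₂₁₆-mod8 pa pc pw y-odd) m≡5∨7)

  -- Parametrisations of the solution sets

  swapIf : Bool → ℤ⁴ → ℤ⁴
  swapIf false v               = v
  swapIf true  (x , y , z , w) = (y , x , z , w)

  Q₁₁₄₆-swapIf : ∀ b v → Q₁₁₄₆ (swapIf b v) ≡ Q₁₁₄₆ v
  Q₁₁₄₆-swapIf false v               = refl
  Q₁₁₄₆-swapIf true  (x , y , z , w) = cong (λ s → s + + 4 * (z * z) + + 6 * (w * w)) (ℤ.+-comm (y * y) (x * x))

  ρ : Bool × ℤ⁴ → ℤ⁴
  ρ (b , p , y , z , w) = swapIf b (+ 2 * p , y , z , w)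

  Bool×Q₄₁₄₆↔Q₁₁₄₆ : ∀ {m} → Odd m →
                     Σ (Bool × ℤ⁴) (λ (_ , π) → Q₄₁₄₆ π ≡ m) ↔ Solutions Q₁₁₄₆ m
  Bool×Q₄₁₄₆↔Q₁₁₄₆ {m} m-odd =
    Σ-map-↔ ρ uip uip (λ {(b , π)} → trans (Q₁₁₄₆-swapIf b _)) ρ-injective ρ-onto
    where
    y-odd : ∀ p y z w → Q₄₁₄₆ (p , y , z , w) ≡ m → Odd y
    y-odd p y z w Q≡m with Q₁₁₄₆-parity (+ 2 * p) y z w (subst Odd (sym Q≡m) m-odd)
    ... | inj₁ (_ , odd-y) = odd-y
    ... | inj₂ (2p-odd , _) = ⊥-elim (Even-Odd-disjoint (_ , refl) 2p-odd)

    double-injective : ∀ p p′ {u u′ : ℤ × ℤ × ℤ} → (+ 2 * p , u) ≡ (+ 2 * p′ , u′) → (p , u) ≡ (p′ , u′)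
    double-injective p p′ e with ,-injectiveʳ e
    ... | refl = cong (_, _) (ℤ.*-cancelˡ-≡ (+ 2) p p′ (,-injectiveˡ e))

    ρ-injective : ∀ {x x′} → Q₄₁₄₆ (proj₂ x) ≡ m → Q₄₁₄₆ (proj₂ x′) ≡ m →
                  ρ x ≡ ρ x′ → x ≡ x′
    ρ-injective {false , p , _} {false , p′ , _} _ _ e = cong (false ,_) (double-injective p p′ e)
    ρ-injective {true  , p , _} {true  , p′ , _} _ _ e = cong (true ,_) (double-injective p p′ (cong (swapIf true) e))
    ρ-injective {false , p , _} {true , p′ , y′ , z′ , w′} _ Q′≡m e =
      ⊥-elim (Even-Odd-disjoint (p , sym (,-injectiveˡ e)) (y-odd p′ y′ z′ w′ Q′≡m))
    ρ-injective {true , p , y , z , w} {false , p′ , _} Q≡m _ e =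
      ⊥-elim (Even-Odd-disjoint (p′ , ,-injectiveˡ e) (y-odd p y z w Q≡m))

    ρ-onto : ∀ {v} → Q₁₁₄₆ v ≡ m → ∃ λ x → Q₄₁₄₆ (proj₂ x) ≡ m × ρ x ≡ v
    ρ-onto {x , y , z , w} Q≡m with Q₁₁₄₆-parity x y z w (subst Odd (sym Q≡m) m-odd)
    ... | inj₁ ((p , refl) , _) = (false , p , y , z , w) , Q≡m , refl
    ... | inj₂ (_ , (p , refl)) = (true , p , x , z , w) , trans (Q₁₁₄₆-swapIf true (x , + 2 * p , z , w)) Q≡m , refl

  κ : ℤ⁴ → ℤ⁴
  κ (p , y , z , w) = (z - p , p + z , y , w)

  Q₂₂₁₆-κ : ∀ π → Q₂₂₁₆ (κ π) ≡ Q₄₁₄₆ π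
  Q₂₂₁₆-κ (p , y , z , w) = begin
    + 2 * ((z - p) * (z - p)) + + 2 * ((p + z) * (p + z)) + y * y + + 6 * (w * w) ≡⟨ solve (p ∷ y ∷ z ∷ w ∷ []) ⟩
    (+ 2 * p) * (+ 2 * p) + y * y + + 4 * (z * z) + + 6 * (w * w)                 ∎

  Q₄₁₄₆↔Q₂₂₁₆ : ∀ {m} → m ≡5∨7mod8 → Solutions Q₄₁₄₆ m ↔ Solutions Q₂₂₁₆ m
  Q₄₁₄₆↔Q₂₂₁₆ {m} m≡5∨7 = Σ-map-↔ κ uip uip (λ {π} → trans (Q₂₂₁₆-κ π)) κ-injective κ-onto
    where
    κ-injective : ∀ {π π′} → Q₄₁₄₆ π ≡ m → Q₄₁₄₆ π′ ≡ m → κ π ≡ κ π′ → π ≡ π′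
    κ-injective {p , y , z , w} {p′ , y′ , z′ , w′} _ _ e with ,-injectiveʳ (,-injectiveʳ e)
    ... | refl = componentwise (ℤ.*-cancelˡ-≡ (+ 2) p p′ 2p≡2p′) refl (ℤ.*-cancelˡ-≡ (+ 2) z z′ 2z≡2z′) refl
      where
      z-p≡ : z - p ≡ z′ - p′
      z-p≡ = ,-injectiveˡ e
      p+z≡ : p + z ≡ p′ + z′
      p+z≡ = ,-injectiveˡ (,-injectiveʳ e)
      2p≡2p′ : + 2 * p ≡ + 2 * p′
      2p≡2p′ = begin
        + 2 * p               ≡⟨ solve (p ∷ z ∷ []) ⟩
        (p + z) - (z - p)     ≡⟨ cong₂ _-_ p+z≡ z-p≡ ⟩
        (p′ + z′) - (z′ - p′) ≡⟨ solve (p′ ∷ z′ ∷ []) ⟩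
        + 2 * p′              ∎
      2z≡2z′ : + 2 * z ≡ + 2 * z′
      2z≡2z′ = begin
        + 2 * z               ≡⟨ solve (p ∷ z ∷ []) ⟩
        (z - p) + (p + z)     ≡⟨ cong₂ _+_ z-p≡ p+z≡ ⟩
        (z′ - p′) + (p′ + z′) ≡⟨ solve (p′ ∷ z′ ∷ []) ⟩
        + 2 * z′              ∎

    κ-onto : ∀ {v} → Q₂₂₁₆ v ≡ m → ∃ λ π → Q₄₁₄₆ π ≡ m × κ π ≡ v
    κ-onto {a , c , y , w} Q≡m
      with _ , (k , a+c≡2k) , _ ← Q₂₂₁₆-parities {a} {c} {y} {w} m≡5∨7 Q≡m
      with refl ← m+n≡o⇒n≡o-m {a} {c} a+c≡2k
      = π , trans (sym (Q₂₂₁₆-κ π)) (trans (cong Q₂₂₁₆ κπ≡v) Q≡m) , κπ≡v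
      where
      π : ℤ⁴
      π = (k - a , y , k , w)
      κπ≡v : κ π ≡ (a , + 2 * k - a , y , w)
      κπ≡v = componentwise (begin k - (k - a) ≡⟨ solve (k ∷ a ∷ []) ⟩ a ∎)
                           (begin k - a + k ≡⟨ solve (k ∷ a ∷ []) ⟩ + 2 * k - a ∎) refl refl

  τ : Bool × Bool × ℤ⁴ → ℤ⁴
  τ (b₁ , b₂ , a , c , y , w) =
    (+ 2 * c + (a - + 3 * w) , negateIf b₁ (+ 2 * c - (a - + 3 * w)) , y , negateIf b₂ (a + w))

  Q₁₁₄₆-τ : ∀ b₁ b₂ π → Q₁₁₄₆ (τ (b₁ , b₂ , π)) ≡ + 4 * Q₂₂₁₆ π
  Q₁₁₄₆-τ b₁ b₂ (a , c , y , w) = begin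
    (+ 2 * c + (a - + 3 * w)) * (+ 2 * c + (a - + 3 * w))
      + negateIf b₁ (+ 2 * c - (a - + 3 * w)) * negateIf b₁ (+ 2 * c - (a - + 3 * w))
      + + 4 * (y * y) + + 6 * (negateIf b₂ (a + w) * negateIf b₂ (a + w))
      ≡⟨ cong₂ (λ s t → (+ 2 * c + (a - + 3 * w)) * (+ 2 * c + (a - + 3 * w)) + s + + 4 * (y * y) + + 6 * t)
               (negateIf-square b₁ _) (negateIf-square b₂ _) ⟩
    (+ 2 * c + (a - + 3 * w)) * (+ 2 * c + (a - + 3 * w))
      + (+ 2 * c - (a - + 3 * w)) * (+ 2 * c - (a - + 3 * w))
      + + 4 * (y * y) + + 6 * ((a + w) * (a + w))
      ≡⟨ solve (a ∷ c ∷ y ∷ w ∷ []) ⟩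
    + 4 * (+ 2 * (a * a) + + 2 * (c * c) + y * y + + 6 * (w * w)) ∎

  τ-normal-forms : ∀ {b₁ b₂ a c y w X Y Z W} → τ (b₁ , b₂ , a , c , y , w) ≡ (X , Y , Z , W) →
                   negateIf b₁ Y ≡ - X + + 4 * c × negateIf b₂ W ≡ (X - + 2 * c) + + 4 * w ×
                   a ≡ (X - + 2 * c) + + 3 * w × y ≡ Z
  τ-normal-forms {b₁} {b₂} {a} {c} {y} {w} refl =
    trans (negateIf-involutive b₁ _) (begin
      + 2 * c - (a - + 3 * w)                    ≡⟨ solve (a ∷ c ∷ w ∷ []) ⟩
      - (+ 2 * c + (a - + 3 * w)) + + 4 * c      ∎) ,
    trans (negateIf-involutive b₂ _) (begin
      a + w                                      ≡⟨ solve (a ∷ c ∷ w ∷ []) ⟩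
      (+ 2 * c + (a - + 3 * w) - + 2 * c) + + 4 * w ∎) ,
    (begin a ≡⟨ solve (a ∷ c ∷ w ∷ []) ⟩ (+ 2 * c + (a - + 3 * w) - + 2 * c) + + 3 * w ∎) ,
    refl

  AllOdd : ℤ⁴ → Set
  AllOdd (x , y , z , w) = Odd x × Odd y × Odd z × Odd w

  OddSolutions : (ℤ⁴ → ℤ) → ℤ → Set
  OddSolutions Φ m = Σ ℤ⁴ λ v → AllOdd v × Φ v ≡ m

  AllOdd×≡-irrelevant : ∀ v {n m : ℤ} → Irrelevant (AllOdd v × n ≡ m)
  AllOdd×≡-irrelevant _ ((x₁ , y₁ , z₁ , w₁) , e₁) ((x₂ , y₂ , z₂ , w₂) , e₂) =
    cong₂ _,_ (cong₂ _,_ (Odd-irrelevant x₁ x₂) (cong₂ _,_ (Odd-irrelevant y₁ y₂)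
                (cong₂ _,_ (Odd-irrelevant z₁ z₂) (Odd-irrelevant w₁ w₂))))
              (uip e₁ e₂)

  Bool²×Q₂₂₁₆↔oddQ₁₁₄₆ : ∀ {m} → m ≡5∨7mod8 →
                         Σ (Bool × Bool × ℤ⁴) (λ (_ , _ , π) → Q₂₂₁₆ π ≡ m) ↔
                         OddSolutions Q₁₁₄₆ (+ 4 * m)
  Bool²×Q₂₂₁₆↔oddQ₁₁₄₆ {m} m≡5∨7 = Σ-map-↔ τ uip (λ {v} → AllOdd×≡-irrelevant v)
    (λ {x} → τ-sound {x}) (λ {x x′} → τ-injective {x} {x′}) (λ {v} → τ-onto {v})
    where
    τ-sound : ∀ {x} → Q₂₂₁₆ (proj₂ (proj₂ x)) ≡ m → AllOdd (τ x) × Q₁₁₄₆ (τ x) ≡ + 4 * m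
    τ-sound {b₁ , b₂ , a , c , y , w} Q≡m
      with y-odd , _ , (k , a+w≡2k-1) ← Q₂₂₁₆-parities {a} {c} {y} {w} m≡5∨7 Q≡m
      with refl ← m+n≡o⇒m≡o-n {a} {w} a+w≡2k-1
      = (X-odd , Odd-negateIf b₁ Y-odd , y-odd , Odd-negateIf b₂ W-odd) ,
        trans (Q₁₁₄₆-τ b₁ b₂ (+ 2 * k - + 1 - w , c , y , w)) (cong (+ 4 *_) Q≡m)
      where
      X-odd : Odd (+ 2 * c + ((+ 2 * k - + 1 - w) - + 3 * w))
      X-odd = c + k - + 2 * w , (begin
        + 2 * c + ((+ 2 * k - + 1 - w) - + 3 * w) ≡⟨ solve (c ∷ k ∷ w ∷ []) ⟩
        + 2 * (c + k - + 2 * w) - + 1             ∎)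
      Y-odd : Odd (+ 2 * c - ((+ 2 * k - + 1 - w) - + 3 * w))
      Y-odd = c - k + + 2 * w + + 1 , (begin
        + 2 * c - ((+ 2 * k - + 1 - w) - + 3 * w) ≡⟨ solve (c ∷ k ∷ w ∷ []) ⟩
        + 2 * (c - k + + 2 * w + + 1) - + 1       ∎)
      W-odd : Odd ((+ 2 * k - + 1 - w) + w)
      W-odd = k , (begin (+ 2 * k - + 1 - w) + w ≡⟨ solve (k ∷ w ∷ []) ⟩ + 2 * k - + 1 ∎)

    τ-injective : ∀ {x x′} → Q₂₂₁₆ (proj₂ (proj₂ x)) ≡ m → Q₂₂₁₆ (proj₂ (proj₂ x′)) ≡ m →
                  τ x ≡ τ x′ → x ≡ x′
    τ-injective {x@(b₁ , b₂ , a , c , y , w)} {b₁′ , b₂′ , a′ , c′ , y′ , w′} Q≡m _ e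
      with (X-odd , _) , _ ← τ-sound {x} Q≡m
      with nf₁ , nf₂ , a≡ , y≡ ← τ-normal-forms {b₁} {b₂} {a} {c} {y} {w} refl
      with nf₁′ , nf₂′ , a′≡ , y′≡ ← τ-normal-forms {b₁′} {b₂′} {a′} {c′} {y′} {w′} (sym e)
      with refl , refl ← sign-normalisation-unique b₁ b₁′ (Odd-neg X-odd) nf₁ nf₁′
      with refl , refl ← sign-normalisation-unique b₂ b₂′ (Odd-shift c X-odd) nf₂ nf₂′
      = cong₂ (λ a y → (b₁ , b₂ , a , c , y , w)) (trans a≡ (sym a′≡)) (trans y≡ (sym y′≡))

    τ-onto : ∀ {v} → AllOdd v × Q₁₁₄₆ v ≡ + 4 * m →
             ∃ λ x → Q₂₂₁₆ (proj₂ (proj₂ x)) ≡ m × τ x ≡ v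
    τ-onto {X , Y , Z , W} ((X-odd , Y-odd , _ , W-odd) , Q≡4m)
      with b₁ , c , nf₁ ← sign-normalisation (Odd-neg X-odd) Y-odd
      with b₂ , w , nf₂ ← sign-normalisation (Odd-shift c X-odd) W-odd
      = (b₁ , b₂ , π) ,
        ℤ.*-cancelˡ-≡ (+ 4) _ _ (trans (sym (Q₁₁₄₆-τ b₁ b₂ π)) (trans (cong Q₁₁₄₆ τπ≡v) Q≡4m)) ,
        τπ≡v
      where
      π : ℤ⁴
      π = ((X - + 2 * c) + + 3 * w , c , Z , w)
      τπ≡v : τ (b₁ , b₂ , π) ≡ (X , Y , Z , W)
      τπ≡v = componentwise
        (begin + 2 * c + (((X - + 2 * c) + + 3 * w) - + 3 * w) ≡⟨ solve (X ∷ c ∷ w ∷ []) ⟩ X ∎)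
        (begin
          negateIf b₁ (+ 2 * c - (((X - + 2 * c) + + 3 * w) - + 3 * w))
            ≡⟨ cong (negateIf b₁) (begin
                 + 2 * c - (((X - + 2 * c) + + 3 * w) - + 3 * w) ≡⟨ solve (X ∷ c ∷ w ∷ []) ⟩
                 - X + + 4 * c                                   ≡⟨ sym nf₁ ⟩
                 negateIf b₁ Y                                   ∎) ⟩
          negateIf b₁ (negateIf b₁ Y)
            ≡⟨ negateIf-involutive b₁ Y ⟩
          Y ∎)
        refl
        (begin
          negateIf b₂ (((X - + 2 * c) + + 3 * w) + w)
            ≡⟨ cong (negateIf b₂) (begin
                 ((X - + 2 * c) + + 3 * w) + w ≡⟨ solve (X ∷ c ∷ w ∷ []) ⟩
                 (X - + 2 * c) + + 4 * w       ≡⟨ sym nf₂ ⟩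
                 negateIf b₂ W                 ∎) ⟩
          negateIf b₂ (negateIf b₂ W)
            ≡⟨ negateIf-involutive b₂ W ⟩
          W ∎)

  -- The counting functions t and N

  tri-pos : ∀ j → tri (+ ℕ.suc j) ≡ triangle j
  tri-pos j = begin
    ∣ + ℕ.suc j * + j ∣ ℕ./ 2 ≡⟨ cong (ℕ._/ 2) (trans (ℤ.abs-* (+ ℕ.suc j) (+ j)) (ℕ.*-comm (ℕ.suc j) j)) ⟩
    (j ℕ.* ℕ.suc j) ℕ./ 2     ≡⟨ cong (ℕ._/ 2) (sym (triangle*2 j)) ⟩
    (triangle j ℕ.* 2) ℕ./ 2  ≡⟨ m*n/n≡m (triangle j) 2 ⟩
    triangle j                ∎

  -- Here -[1+ j ] - + 1 reduces to -[1+ suc (j + 0) ].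
  tri-neg : ∀ j → tri -[1+ j ] ≡ triangle (ℕ.suc j)
  tri-neg j = begin
    ∣ -[1+ j ] * -[1+ ℕ.suc (j ℕ.+ 0) ] ∣ ℕ./ 2   ≡⟨ cong (ℕ._/ 2) (trans (ℤ.abs-* -[1+ j ] -[1+ ℕ.suc (j ℕ.+ 0) ])
                                                      (cong (λ k → ℕ.suc j ℕ.* ℕ.suc (ℕ.suc k)) (ℕ.+-identityʳ j))) ⟩
    (ℕ.suc j ℕ.* ℕ.suc (ℕ.suc j)) ℕ./ 2           ≡⟨ cong (ℕ._/ 2) (sym (triangle*2 (ℕ.suc j))) ⟩
    (triangle (ℕ.suc j) ℕ.* 2) ℕ./ 2              ≡⟨ m*n/n≡m (triangle (ℕ.suc j)) 2 ⟩
    triangle (ℕ.suc j)                             ∎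

  ∣x∣≤1+tri : ∀ x → ∣ x ∣ ℕ.≤ ℕ.suc (tri x)
  ∣x∣≤1+tri (+ ℕ.zero)  = ℕ.z≤n
  ∣x∣≤1+tri (+ ℕ.suc j) = subst (λ t → ℕ.suc j ℕ.≤ ℕ.suc t) (sym (tri-pos j)) (ℕ.s≤s (n≤triangle j))
  ∣x∣≤1+tri -[1+ j ]    = subst (λ t → ℕ.suc j ℕ.≤ ℕ.suc t) (sym (tri-neg j))
                                (ℕ.m≤n⇒m≤1+n (ℕ.m≤m+n (ℕ.suc j) (triangle j)))

  +triangle*2 : ∀ k → + triangle k * + 2 ≡ + k * (+ 1 + + k)
  +triangle*2 k = trans (sym (ℤ.pos-* (triangle k) 2)) (trans (cong +_ (triangle*2 k)) (ℤ.pos-* k (ℕ.suc k)))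

  8t+1≡square : ∀ t u → t * + 2 ≡ u * (+ 1 + u) →
                     + 8 * t + + 1 ≡ (+ 2 * (+ 1 + u) - + 1) * (+ 2 * (+ 1 + u) - + 1) ×
                     + 8 * t + + 1 ≡ (+ 2 * (- u) - + 1) * (+ 2 * (- u) - + 1)
  8t+1≡square t u t*2≡ =
    trans 8t+1≡ (begin
      + 4 * (u * (+ 1 + u)) + + 1 ≡⟨ solve (u ∷ []) ⟩ (+ 2 * (+ 1 + u) - + 1) * (+ 2 * (+ 1 + u) - + 1) ∎) ,
    trans 8t+1≡ (begin
      + 4 * (u * (+ 1 + u)) + + 1 ≡⟨ solve (u ∷ []) ⟩ (+ 2 * (- u) - + 1) * (+ 2 * (- u) - + 1) ∎)
    where
    8t+1≡ : + 8 * t + + 1 ≡ + 4 * (u * (+ 1 + u)) + + 1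
    8t+1≡ = begin
      + 8 * t + + 1         ≡⟨ solve (t ∷ []) ⟩
      + 4 * (t * + 2) + + 1 ≡⟨ cong (λ s → + 4 * s + + 1) t*2≡ ⟩
      + 4 * (u * (+ 1 + u)) + + 1 ∎

  8tri+1≡square : ∀ x → + 8 * + tri x + + 1 ≡ (+ 2 * x - + 1) * (+ 2 * x - + 1)
  8tri+1≡square (+ ℕ.zero)  = refl
  8tri+1≡square (+ ℕ.suc j) = trans (cong (λ t → + 8 * + t + + 1) (tri-pos j))
                                  (proj₁ (8t+1≡square (+ triangle j) (+ j) (+triangle*2 j)))
  8tri+1≡square -[1+ j ]    = trans (cong (λ t → + 8 * + t + + 1) (tri-neg j))
                                  (proj₂ (8t+1≡square (+ triangle (ℕ.suc j)) (+ ℕ.suc j) (+triangle*2 (ℕ.suc j))))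

  +-weighted-sum : ∀ p q r s → + (1 ℕ.* p ℕ.+ 1 ℕ.* q ℕ.+ 4 ℕ.* r ℕ.+ 6 ℕ.* s) ≡ + p + + q + + 4 * + r + + 6 * + s
  +-weighted-sum p q r s =
    cong₂ _+_ (cong₂ _+_ (cong₂ _+_ (cong +_ (ℕ.*-identityˡ p)) (cong +_ (ℕ.*-identityˡ q))) (ℤ.pos-* 4 r)) (ℤ.pos-* 6 s)

  +sq : ∀ x → + sq x ≡ x * x
  +sq (+ n)     = trans (cong +_ (ℤ.abs-◃ _ _)) (sym (ℤ.+◃n≡+n _))
  +sq -[1+ n ] = refl

  qform-Q₁₁₄₆ : ∀ v → + qform 1 1 4 6 v ≡ Q₁₁₄₆ v
  qform-Q₁₁₄₆ (x , y , z , w) = trans (+-weighted-sum (sq x) (sq y) (sq z) (sq w))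
    (cong (λ (s₁ , s₂ , s₃ , s₄) → s₁ + s₂ + + 4 * s₃ + + 6 * s₄) (componentwise (+sq x) (+sq y) (+sq z) (+sq w)))

  odds : ℤ⁴ → ℤ⁴
  odds (a₁ , a₂ , a₃ , a₄) = (+ 2 * a₁ - + 1 , + 2 * a₂ - + 1 , + 2 * a₃ - + 1 , + 2 * a₄ - + 1)

  tform-Q₁₁₄₆ : ∀ a → + 8 * + tform 1 1 4 6 a + + 12 ≡ Q₁₁₄₆ (odds a)
  tform-Q₁₁₄₆ (a₁ , a₂ , a₃ , a₄) = begin
    + 8 * + tform 1 1 4 6 (a₁ , a₂ , a₃ , a₄) + + 12
      ≡⟨ cong (λ s → + 8 * s + + 12) (+-weighted-sum (tri a₁) (tri a₂) (tri a₃) (tri a₄)) ⟩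
    + 8 * (+ tri a₁ + + tri a₂ + + 4 * + tri a₃ + + 6 * + tri a₄) + + 12
      ≡⟨ regroup (+ tri a₁) (+ tri a₂) (+ tri a₃) (+ tri a₄) ⟩
    (+ 8 * + tri a₁ + + 1) + (+ 8 * + tri a₂ + + 1) + + 4 * (+ 8 * + tri a₃ + + 1) + + 6 * (+ 8 * + tri a₄ + + 1)
      ≡⟨ cong (λ (s₁ , s₂ , s₃ , s₄) → s₁ + s₂ + + 4 * s₃ + + 6 * s₄)
              (componentwise (8tri+1≡square a₁) (8tri+1≡square a₂) (8tri+1≡square a₃) (8tri+1≡square a₄)) ⟩
    Q₁₁₄₆ (odds (a₁ , a₂ , a₃ , a₄)) ∎
    where
    regroup : ∀ t₁ t₂ t₃ t₄ → + 8 * (t₁ + t₂ + + 4 * t₃ + + 6 * t₄) + + 12 ≡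
              (+ 8 * t₁ + + 1) + (+ 8 * t₂ + + 1) + + 4 * (+ 8 * t₃ + + 1) + + 6 * (+ 8 * t₄ + + 1)
    regroup = solve-∀

  qform-solution∈box : ∀ {m v} → qform 1 1 4 6 v ≡ m → v ∈ box m
  qform-solution∈box = ∈-box-if-weighted-sum sq (λ {x} sq≤m → ℕ.≤-trans (∣x∣≤sq x) sq≤m)

  tform-solution∈box : ∀ {n v} → tform 1 1 4 6 v ≡ n → v ∈ box (2 ℕ.* n ℕ.+ 1)
  tform-solution∈box {n} =
    ∈-box-if-weighted-sum tri (λ {x} tri≤n → ℕ.≤-trans (∣x∣≤1+tri x) (1+n≤2n+1 (ℕ.s≤s tri≤n)))
    where
    1+n≤2n+1 : ∀ {k} → k ℕ.≤ ℕ.suc n → k ℕ.≤ 2 ℕ.* n ℕ.+ 1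
    1+n≤2n+1 k≤1+n = ℕ.≤-trans k≤1+n (subst (ℕ.suc n ℕ.≤_) (ℕ.+-comm 1 (2 ℕ.* n)) (ℕ.s≤s (ℕ.m≤m+n n _)))

  tform↔Bool²×Q₂₂₁₆ : ∀ n → + (2 ℕ.* n ℕ.+ 3) ≡5∨7mod8 →
    Σ ℤ⁴ (λ a → tform 1 1 4 6 a ≡ n) ↔ (Bool × Bool × Solutions Q₂₂₁₆ (+ (2 ℕ.* n ℕ.+ 3)))
  tform↔Bool²×Q₂₂₁₆ n m≡5∨7 =
    ↔-trans (Σ-map-↔ odds ℕ.≡-irrelevant (λ {v} → AllOdd×≡-irrelevant v)
                 (λ {a} → odds-sound {a}) (λ {a a′} → odds-injective {a} {a′}) (λ {v} → odds-onto {v}))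
    (↔-trans (↔-sym (Bool²×Q₂₂₁₆↔oddQ₁₁₄₆ m≡5∨7))
    (↔-trans Σ-assoc-alt (↔-refl ×-↔ Σ-assoc-alt)))
    where
    8n+12≡4m : + 8 * + n + + 12 ≡ + 4 * + (2 ℕ.* n ℕ.+ 3)
    8n+12≡4m = trans (regroup (+ n)) (cong (λ s → + 4 * (s + + 3)) (sym (ℤ.pos-* 2 n)))
      where
      regroup : ∀ k → + 8 * k + + 12 ≡ + 4 * (+ 2 * k + + 3)
      regroup = solve-∀

    odds-sound : ∀ {a} → tform 1 1 4 6 a ≡ n →
                 AllOdd (odds a) × Q₁₁₄₆ (odds a) ≡ + 4 * + (2 ℕ.* n ℕ.+ 3)
    odds-sound {a₁ , a₂ , a₃ , a₄} refl =
      ((a₁ , refl) , (a₂ , refl) , (a₃ , refl) , (a₄ , refl)) ,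
      trans (sym (tform-Q₁₁₄₆ (a₁ , a₂ , a₃ , a₄))) 8n+12≡4m

    odds-injective : ∀ {a a′} → tform 1 1 4 6 a ≡ n → tform 1 1 4 6 a′ ≡ n →
                     odds a ≡ odds a′ → a ≡ a′
    odds-injective _ _ e =
      componentwise (odd-injective (,-injectiveˡ e))
                    (odd-injective (,-injectiveˡ (,-injectiveʳ e)))
                    (odd-injective (,-injectiveˡ (,-injectiveʳ (,-injectiveʳ e))))
                    (odd-injective (,-injectiveʳ (,-injectiveʳ (,-injectiveʳ e))))

    odds-onto : ∀ {v} → AllOdd v × Q₁₁₄₆ v ≡ + 4 * + (2 ℕ.* n ℕ.+ 3) →
                ∃ λ a → tform 1 1 4 6 a ≡ n × odds a ≡ v
    odds-onto (((k₁ , refl) , (k₂ , refl) , (k₃ , refl) , (k₄ , refl)) , Q≡4m) =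
      (k₁ , k₂ , k₃ , k₄) ,
      ℤ.+-injective (ℤ.*-cancelˡ-≡ (+ 8) _ _ (∙-cancelʳ (+ 12) _ _
        (trans (tform-Q₁₁₄₆ (k₁ , k₂ , k₃ , k₄)) (trans Q≡4m (sym 8n+12≡4m))))) ,
      refl

  qform↔Bool×Q₂₂₁₆ : ∀ m → + m ≡5∨7mod8 →
    Σ ℤ⁴ (λ v → qform 1 1 4 6 v ≡ m) ↔ (Bool × Solutions Q₂₂₁₆ (+ m))
  qform↔Bool×Q₂₂₁₆ m m≡5∨7 =
    ↔-trans (Σ-map-↔ (λ v → v) ℕ.≡-irrelevant uip
                     (λ {v} e → trans (sym (qform-Q₁₁₄₆ v)) (cong +_ e)) (λ _ _ e → e)
                     (λ {v} e → v , ℤ.+-injective (trans (qform-Q₁₁₄₆ v) e) , refl))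
    (↔-trans (↔-sym (Bool×Q₄₁₄₆↔Q₁₁₄₆ (≡5∨7mod8⇒Odd m≡5∨7)))
    (↔-trans Σ-assoc-alt (↔-refl ×-↔ Q₄₁₄₆↔Q₂₂₁₆ m≡5∨7)))

  5∨7mod8-from-mod4 : ∀ {x} q → x ≡ + 1 + q * + 4 ⊎ x ≡ + 2 + q * + 4 → + 2 * x + + 3 ≡5∨7mod8
  5∨7mod8-from-mod4 q (inj₁ refl) = inj₁ (congruent (divides q (begin
    + 2 * (+ 1 + q * + 4) + + 3 - + 5 ≡⟨ solve (q ∷ []) ⟩ q * + 8 ∎)))
  5∨7mod8-from-mod4 q (inj₂ refl) = inj₂ (congruent (divides q (begin
    + 2 * (+ 2 + q * + 4) + + 3 - + 7 ≡⟨ solve (q ∷ []) ⟩ q * + 8 ∎)))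

  2n+3≡5∨7mod8 : ∀ n → n ℕ.% 4 ≡ 1 ⊎ n ℕ.% 4 ≡ 2 → + (2 ℕ.* n ℕ.+ 3) ≡5∨7mod8
  2n+3≡5∨7mod8 n n%4≡1∨2 =
    subst _≡5∨7mod8 (cong (_+ + 3) (sym (ℤ.pos-* 2 n)))
      (5∨7mod8-from-mod4 (+ (n ℕ./ 4)) (Sum.map +n≡ +n≡ n%4≡1∨2))
    where
    +n≡ : ∀ {r} → n ℕ.% 4 ≡ r → + n ≡ + r + + (n ℕ./ 4) * + 4
    +n≡ {r} refl = trans (cong +_ (m≡m%n+[m/n]*n n 4)) (cong (λ s → + (n ℕ.% 4) + s) (ℤ.pos-* (n ℕ./ 4) 4))

  t-as-tform-solutions : ∀ n → Fin (t 1 1 4 6 n) ↔ Σ ℤ⁴ (λ a → tform 1 1 4 6 a ≡ n)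
  t-as-tform-solutions n = Fin-length-filter (λ a → tform 1 1 4 6 a ℕ.≟ n) ℕ.≡-irrelevant
                             (box-unique (2 ℕ.* n ℕ.+ 1)) tform-solution∈box

  N-as-qform-solutions : ∀ m → Fin (N 1 1 4 6 m) ↔ Σ ℤ⁴ (λ v → qform 1 1 4 6 v ≡ m)
  N-as-qform-solutions m = Fin-length-filter (λ v → qform 1 1 4 6 v ℕ.≟ m) ℕ.≡-irrelevant
                             (box-unique m) qform-solution∈box

open import Data.Fin using (Fin)
open import Data.Fin.Permutation using (↔⇒≡)
open import Data.Fin.Properties using (2↔Bool; *↔×)
open import Data.Nat using (ℕ; _+_; _*_; _%_; _≤_)
open import Data.Product.Function.NonDependent.Propositional using (_×-↔_)
open import Function.Properties.Inverse using (↔-refl; ↔-sym)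
open import Function.Related.Propositional using (module EquationalReasoning)
open EquationalReasoning

theorem2p11 : (n : ℕ) → 1 ≤ n → (n % 4 ≡ 1 ⊎ n % 4 ≡ 2) →
    t 1 1 4 6 n ≡ 2 * N 1 1 4 6 (2 * n + 3)
theorem2p11 n _ n%4≡1∨2 = ↔⇒≡ (begin
  Fin (t 1 1 4 6 n)
    ↔⟨ t-as-tform-solutions n ⟩
  Σ ℤ⁴ (λ a → tform 1 1 4 6 a ≡ n)
    ↔⟨ tform↔Bool²×Q₂₂₁₆ n m≡5∨7 ⟩
  (Bool × Bool × Solutions Q₂₂₁₆ (+ (2 * n + 3)))
    ↔⟨ ↔-refl ×-↔ ↔-sym (qform↔Bool×Q₂₂₁₆ (2 * n + 3) m≡5∨7) ⟩
  (Bool × Σ ℤ⁴ (λ v → qform 1 1 4 6 v ≡ 2 * n + 3))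
    ↔⟨ ↔-sym 2↔Bool ×-↔ ↔-sym (N-as-qform-solutions (2 * n + 3)) ⟩
  (Fin 2 × Fin (N 1 1 4 6 (2 * n + 3)))
    ↔⟨ ↔-sym *↔× ⟩
  Fin (2 * N 1 1 4 6 (2 * n + 3))
    ∎)
  where
  m≡5∨7 : + (2 * n + 3) ≡5∨7mod8
  m≡5∨7 = 2n+3≡5∨7mod8 n n%4≡1∨2
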